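{- If $H$ is a retract of a finite graph $G$, then $B(H) \leq B(G)$.
   Context: A subgraph $H$ of $G$ is a retract of $G$ if there is a map $r: V(G)\to V(H)$ that is the identity on $V(H)$ and maps adjacent vertices of $G$ to adjacent or equal vertices of $H$ (a retraction). Bodyguards and Presidents is a two-player game on a finite simple graph $G$. One player controls a set of tokens called bodyguards, the other a single token called the president. First all bodyguards are placed on vertices (several may share a vertex), then the president is placed. The players then alternate turns, bodyguards first; on a player's turn, each token they control either moves to an adjacent vertex or stays put. The president is surrounded if every vertex of the open neighbourhood of the president's vertex is occupied by a bodyguard. The bodyguards win if there is a finite time after which, at the end of every bodyguard turn, the president is surrounded; otherwise the president wins. The bodyguard number $B(G)$ is the minimum number of bodyguards that guarantees a win for the bodyguards on $G$ (with $B(G)=0$ for the edgeless graph). -}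

module Defs where

open import Data.Nat using (ℕ; zero; suc; _≤_)
open import Data.Fin using (Fin; toℕ)
open import Data.Vec using (Vec; _∷ʳ_; tabulate)
open import Data.Product using (Σ; ∃; _×_; _,_)
open import Data.Sum using (_⊎_)
open import Data.Empty using (⊥)
open import Relation.Nullary using (¬_)
open import Relation.Binary.PropositionalEquality using (_≡_)
open import Relation.Binary.Definitions using (Decidable)

record Graph : Set₁ where
  field
    n      : ℕ
    Adj    : Fin n → Fin n → Set
    adj?   : Decidable Adj
    sym    : ∀ {u v} → Adj u v → Adj v u
    irrefl : ∀ {u} → ¬ Adj u u

open Graph public

V : Graph → Set
V G = Fin (n G)

Step : (G : Graph) → V G → V G → Set
Step G u v = u ≡ v ⊎ Adj G u v

Config : Graph → ℕ → Set
Config G k = Fin k → V G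

Surrounded : (G : Graph) {k : ℕ} → V G → Config G k → Set
Surrounded G {k} x b = ∀ w → Adj G x w → Σ (Fin k) λ i → b i ≡ w

-- A (deterministic) bodyguard strategy: σ t h is the bodyguard configuration
-- b_t, given the president's positions h = (x_0,…,x_{t-1}) so far.
-- σ 0 [] is the initial placement.
record BGStrategy (G : Graph) (k : ℕ) : Set where
  field
    σ     : (t : ℕ) → Vec (V G) t → Config G k
    legal : ∀ t (h : Vec (V G) t) (x : V G) (i : Fin k) →
            Step G (σ t h i) (σ (suc t) (h ∷ʳ x) i)

open BGStrategy public

LegalPlay : (G : Graph) → (ℕ → V G) → Set
LegalPlay G x = ∀ t → Step G (x t) (x (suc t))

prefix : {A : Set} → (ℕ → A) → (t : ℕ) → Vec A t
prefix x t = tabulate (λ i → x (toℕ i))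

-- At the end of bodyguard turn t+1 the president is at x_t and the
-- bodyguards are at σ (t+1) (x_0,…,x_t).
Winning : (G : Graph) {k : ℕ} → BGStrategy G k → Set
Winning G s = ∀ (x : ℕ → V G) → LegalPlay G x →
  Σ ℕ λ T → ∀ t → T ≤ t → Surrounded G (x t) (σ s (suc t) (prefix x (suc t)))

BodyguardsWin : Graph → ℕ → Set
BodyguardsWin G k = Σ (BGStrategy G k) (Winning G)

IsBodyguardNumber : Graph → ℕ → Set
IsBodyguardNumber G b = BodyguardsWin G b × (∀ k → BodyguardsWin G k → b ≤ k)

record Retract (H G : Graph) : Set where
  field
    ι       : V H → V G
    ι-hom   : ∀ {u v} → Adj H u v → Adj G (ι u) (ι v)
    r       : V G → V H
    r∘ι     : ∀ v → r (ι v) ≡ v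
    r-hom   : ∀ {u v} → Adj G u v → Adj H (r u) (r v) ⊎ r u ≡ r v

{-# OPTIONS --safe #-}
-- The bodyguards on H play a winning G-strategy against the image ι x of the
-- president's play (a legal play in G) and stand at the r-images of the
-- G-bodyguards.  Since r is a retraction their moves stay legal, and since ι
-- preserves adjacency and r fixes H, the president at x is surrounded in H
-- whenever ι x is surrounded in G.
module Submission where

open import Defs
open import Data.Nat using (ℕ; suc; _≤_)
open import Data.Vec using (map)
open import Data.Vec.Properties using (map-∷ʳ; tabulate-∘)
open import Data.Product using (_,_)
open import Data.Sum using (inj₁; inj₂; swap)
open import Function using (_∘_)
open import Relation.Binary.PropositionalEquality using (_≡_; refl; trans; cong; subst)

module _ {G H : Graph} (f : V G → V H)
         (f-step : ∀ {u v} → Adj G u v → Step H (f u) (f v)) where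

  map-step : ∀ {u v} → Step G u v → Step H (f u) (f v)
  map-step (inj₁ refl) = inj₁ refl
  map-step (inj₂ a)    = f-step a

  map-legalPlay : ∀ {x} → LegalPlay G x → LegalPlay H (f ∘ x)
  map-legalPlay lp t = map-step (lp t)

prefix-map : {A B : Set} (f : A → B) (x : ℕ → A) (t : ℕ) →
             prefix (f ∘ x) t ≡ map f (prefix x t)
prefix-map f x t = tabulate-∘ f _

projectStrategy : {G H : Graph} {k : ℕ} (f : V H → V G) (g : V G → V H) →
                  (∀ {u v} → Adj G u v → Step H (g u) (g v)) →
                  BGStrategy G k → BGStrategy H k
σ (projectStrategy f g g-step s) t h = g ∘ σ s t (map f h)
legal (projectStrategy {G} {H} f g g-step s) t h x i rewrite map-∷ʳ f x h =
  map-step {G} {H} g g-step (legal s t (map f h) (f x) i)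

module _ {G H : Graph} (R : Retract H G) where
  open Retract R

  r-step : ∀ {u v} → Adj G u v → Step H (r u) (r v)
  r-step = swap ∘ r-hom

  ι-step : ∀ {u v} → Adj H u v → Step G (ι u) (ι v)
  ι-step = inj₂ ∘ ι-hom

  surrounded-retract : ∀ {k x} {b : Config G k} →
                       Surrounded G (ι x) b → Surrounded H x (r ∘ b)
  surrounded-retract surrounded w x~w with surrounded (ι w) (ι-hom x~w)
  ... | i , bi≡ιw = i , trans (cong r bi≡ιw) (r∘ι w)

  retract-bodyguardsWin : ∀ {k} → BodyguardsWin G k → BodyguardsWin H k
  retract-bodyguardsWin (s , wins) = projectStrategy ι r r-step s , winsH
    where
    winsH : Winning H (projectStrategy ι r r-step s)
    winsH x lp with wins (ι ∘ x) (map-legalPlay {H} {G} ι ι-step lp)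
    ... | T , surroundedG = T , λ t T≤t →
      surrounded-retract
        (subst (Surrounded G (ι (x t)) ∘ σ s (suc t))
               (prefix-map ι x (suc t))
               (surroundedG t T≤t))

theorem2p4 : (G H : Graph) → Retract H G → (bH bG : ℕ) →
    IsBodyguardNumber H bH → IsBodyguardNumber G bG → bH ≤ bG
theorem2p4 G H R bH bG (_ , minimalH) (winsG , _) =
  minimalH bG (retract-bodyguardsWin R winsG)
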